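{- Let $n$ be a positive integer with $X(n) \le 0$, and let $p$ be a prime dividing $n$. Then $X(pn) < 0$.
   Context: For a positive integer $n$, let $\Pi(n)$ denote the sum of the distinct prime divisors of $n$, and let $\mathcal{C}(n)$ denote the sum of all positive divisors of $n$ that are not prime (including $1$ and, when $n$ is not prime, $n$ itself). Define $X(n) = \Pi(n) - \mathcal{C}(n) + n$. -}

module Defs where

open import Data.Nat using (ℕ; zero; suc; _+_)
open import Data.Nat.Divisibility using (_∣_; _∣?_)
open import Data.Nat.Primality using (Prime; prime?)
open import Data.Integer using (ℤ; +_; _-_)
open import Relation.Nullary using (yes; no)

sumPrimeDivUpTo : ℕ → ℕ → ℕ
sumPrimeDivUpTo n zero = 0
sumPrimeDivUpTo n (suc k) with suc k ∣? n | prime? (suc k)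
... | yes _ | yes _ = suc k + sumPrimeDivUpTo n k
... | _     | _     = sumPrimeDivUpTo n k

sumNonPrimeDivUpTo : ℕ → ℕ → ℕ
sumNonPrimeDivUpTo n zero = 0
sumNonPrimeDivUpTo n (suc k) with suc k ∣? n | prime? (suc k)
... | yes _ | no _ = suc k + sumNonPrimeDivUpTo n k
... | _     | _    = sumNonPrimeDivUpTo n k

-- Π(n): sum of the distinct prime divisors of n (n positive; all divisors ≤ n)
Π : ℕ → ℕ
Π n = sumPrimeDivUpTo n n

𝒞 : ℕ → ℕ
𝒞 n = sumNonPrimeDivUpTo n n

X : ℕ → ℤ
X n = (+ Π n) - (+ 𝒞 n) Data.Integer.+ (+ n)

{-# OPTIONS --safe #-}
-- Let σ = Π + 𝒞 be the sum of all divisors; X(n) ≤ 0 says Π(n) + n ≤ 𝒞(n).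
-- As p ∣ n, every prime divisor of pn divides n, so Π(pn) ≤ Π(n).  The
-- divisors of pn include 1 and pd for every d ∣ n, so
--   σ(pn) > p σ(n) = p (Π(n) + 𝒞(n)) ≥ p (2 Π(n) + n) ≥ 2 Π(pn) + pn,
-- which is Π(pn) + pn < 𝒞(pn).
module Submission where

open import Defs
open import Data.Nat using (ℕ; _*_)
open import Data.Nat.Divisibility using (_∣_)
open import Data.Nat.Primality using (Prime)
open import Data.Integer using (+_; _≤_; _<_)

open import Data.Nat as ℕ
  using (zero; suc; _+_; z≤n; s≤s; NonZero; NonTrivial)
open import Data.Nat.Properties
open import Algebra.Properties.CommutativeSemigroup +-commutativeSemigroup
  using (x∙yz≈y∙xz)
open import Data.Nat.Divisibility using (_∣?_; ∣⇒≤; 1∣_; *-monoʳ-∣)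
open import Data.Nat.Primality
  using (prime?; ¬prime[1]; prime⇒nonZero; prime⇒nonTrivial; prime⇒irreducible; euclidsLemma)
open import Data.Integer as ℤ using (_⊖_)
import Data.Integer.Properties as ℤ
open import Data.Sum using (inj₁; inj₂)
open import Relation.Nullary using (yes; no; contradiction)
open import Relation.Binary.PropositionalEquality

sumTo : ℕ → (ℕ → ℕ) → ℕ
sumTo zero    f = 0
sumTo (suc k) f = f (suc k) + sumTo k f

sumTo-mono-≤ : ∀ k {f g} → (∀ d → f d ℕ.≤ g d) → sumTo k f ℕ.≤ sumTo k g
sumTo-mono-≤ zero    f≤g = z≤n
sumTo-mono-≤ (suc k) f≤g = +-mono-≤ (f≤g (suc k)) (sumTo-mono-≤ k f≤g)

*-distribˡ-sumTo : ∀ c k f → c * sumTo k f ≡ sumTo k (λ d → c * f d)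
*-distribˡ-sumTo c zero    f = *-zeroʳ c
*-distribˡ-sumTo c (suc k) f =
  trans (*-distribˡ-+ c (f (suc k)) _) (cong (_+_ (c * f (suc k))) (*-distribˡ-sumTo c k f))

sumTo-monoˡ-≤ : ∀ f {k l} → k ℕ.≤ l → sumTo k f ℕ.≤ sumTo l f
sumTo-monoˡ-≤ f {l = zero}  z≤n = z≤n
sumTo-monoˡ-≤ f {l = suc l} k≤1+l with m≤n⇒m<n∨m≡n k≤1+l
... | inj₂ refl      = ≤-refl
... | inj₁ (s≤s k≤l) = ≤-trans (sumTo-monoˡ-≤ f k≤l) (m≤n+m _ (f (suc l)))

term≤sumTo : ∀ f {d k} → 1 ℕ.≤ d → d ℕ.≤ k → f d ℕ.≤ sumTo k f
term≤sumTo f {k = zero}  (s≤s _) ()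
term≤sumTo f {d} {suc k} 1≤d d≤1+k with m≤n⇒m<n∨m≡n d≤1+k
... | inj₂ refl      = m≤m+n (f d) _
... | inj₁ (s≤s d≤k) = ≤-trans (term≤sumTo f 1≤d d≤k) (m≤n+m _ (f (suc k)))

-- For p ≥ 2 the indices 1, p, 2p, …, (m+1)p are distinct and at most (m+1)p.
sumTo-dilate : ∀ p .{{_ : NonTrivial p}} f m →
               f 1 + sumTo (suc m) (λ d → f (p * d)) ℕ.≤ sumTo (p * suc m) f
sumTo-dilate p@(suc (suc q)) f zero = begin
  f 1 + (f (p * 1) + 0)   ≡⟨ cong (λ x → f 1 + (f x + 0)) (*-identityʳ p) ⟩
  f 1 + (f p + 0)         ≡⟨ cong (_+_ (f 1)) (+-identityʳ (f p)) ⟩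
  f 1 + f p               ≡⟨ +-comm (f 1) (f p) ⟩
  f p + f 1               ≤⟨ +-monoʳ-≤ (f p) (term≤sumTo f (s≤s z≤n) (s≤s z≤n)) ⟩
  sumTo p f               ≡⟨ cong (λ k → sumTo k f) (sym (*-identityʳ p)) ⟩
  sumTo (p * 1) f         ∎
  where open ≤-Reasoning
sumTo-dilate p@(suc (suc q)) f (suc m) = begin
  f 1 + (f (p * suc (suc m)) + rest)      ≡⟨ x∙yz≈y∙xz (f 1) (f (p * suc (suc m))) rest ⟩
  f (p * suc (suc m)) + (f 1 + rest)      ≤⟨ +-monoʳ-≤ (f (p * suc (suc m))) (sumTo-dilate p f m) ⟩
  f (p * suc (suc m)) + sumTo (p * suc m) f
    ≤⟨ +-monoʳ-≤ (f (p * suc (suc m))) (sumTo-monoˡ-≤ f (m≤n+m (p * suc m) (suc q))) ⟩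
  f (p * suc (suc m)) + sumTo (suc q + p * suc m) f
    ≡⟨ cong (λ k → f k + sumTo (suc q + p * suc m) f) (*-suc p (suc m)) ⟩
  sumTo (p + p * suc m) f                 ≡⟨ cong (λ k → sumTo k f) (sym (*-suc p (suc m))) ⟩
  sumTo (p * suc (suc m)) f               ∎
  where
  open ≤-Reasoning
  rest = sumTo (suc m) (λ d → f (p * d))

divisorTerm : ℕ → ℕ → ℕ
divisorTerm n d with d ∣? n
... | yes _ = d
... | no  _ = 0

σ : ℕ → ℕ
σ n = sumTo n (divisorTerm n)

sumPrimeDiv+sumNonPrimeDiv : ∀ n k →
  sumPrimeDivUpTo n k + sumNonPrimeDivUpTo n k ≡ sumTo k (divisorTerm n)
sumPrimeDiv+sumNonPrimeDiv n zero = refl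
sumPrimeDiv+sumNonPrimeDiv n (suc k) with suc k ∣? n | prime? (suc k)
... | yes _ | yes _ = trans (+-assoc (suc k) _ _) (cong (_+_ (suc k)) (sumPrimeDiv+sumNonPrimeDiv n k))
... | yes _ | no  _ = trans (x∙yz≈y∙xz _ (suc k) _) (cong (_+_ (suc k)) (sumPrimeDiv+sumNonPrimeDiv n k))
... | no  _ | _     = sumPrimeDiv+sumNonPrimeDiv n k

Π+𝒞≡σ : ∀ n → Π n + 𝒞 n ≡ σ n
Π+𝒞≡σ n = sumPrimeDiv+sumNonPrimeDiv n n

divisorTerm[1] : ∀ n → divisorTerm n 1 ≡ 1
divisorTerm[1] n with 1 ∣? n
... | yes _  = refl
... | no 1∤n = contradiction (1∣ n) 1∤n

*-divisorTerm≤divisorTerm-* : ∀ p n d → p * divisorTerm n d ℕ.≤ divisorTerm (p * n) (p * d)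
*-divisorTerm≤divisorTerm-* p n d with d ∣? n
... | no _ = ≤-trans (≤-reflexive (*-zeroʳ p)) z≤n
... | yes d∣n with p * d ∣? p * n
...   | yes _     = ≤-refl
...   | no pd∤pn = contradiction (*-monoʳ-∣ p d∣n) pd∤pn

p*σ[n]<σ[p*n] : ∀ p .{{_ : NonTrivial p}} n .{{_ : NonZero n}} → p * σ n ℕ.< σ (p * n)
p*σ[n]<σ[p*n] p n@(suc m) = begin-strict
  p * σ n                 <⟨ n<1+n _ ⟩
  suc (p * σ n)
    ≡⟨ cong₂ _+_ (sym (divisorTerm[1] (p * n))) (*-distribˡ-sumTo p n (divisorTerm n)) ⟩
  divisorTerm (p * n) 1 + sumTo n (λ d → p * divisorTerm n d)
    ≤⟨ +-monoʳ-≤ (divisorTerm (p * n) 1) (sumTo-mono-≤ n (*-divisorTerm≤divisorTerm-* p n)) ⟩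
  divisorTerm (p * n) 1 + sumTo n (λ d → divisorTerm (p * n) (p * d))
    ≤⟨ sumTo-dilate p (divisorTerm (p * n)) m ⟩
  σ (p * n)               ∎
  where open ≤-Reasoning

sumPrimeDivUpTo-mono : ∀ {m n} → (∀ {r} → Prime r → r ∣ m → r ∣ n) →
                       ∀ k → sumPrimeDivUpTo m k ℕ.≤ sumPrimeDivUpTo n k
sumPrimeDivUpTo-mono m⇒n zero = z≤n
sumPrimeDivUpTo-mono {m} {n} m⇒n (suc k)
  with suc k ∣? m | prime? (suc k) | suc k ∣? n
... | yes _   | yes _  | yes _   = +-monoʳ-≤ (suc k) (sumPrimeDivUpTo-mono m⇒n k)
... | yes k∣m | yes pk | no  k∤n = contradiction (m⇒n pk k∣m) k∤n
... | no  _   | yes _  | yes _   = ≤-trans (sumPrimeDivUpTo-mono m⇒n k) (m≤n+m _ (suc k))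
... | no  _   | yes _  | no  _   = sumPrimeDivUpTo-mono m⇒n k
... | yes _   | no  _  | yes _   = sumPrimeDivUpTo-mono m⇒n k
... | yes _   | no  _  | no  _   = sumPrimeDivUpTo-mono m⇒n k
... | no  _   | no  _  | yes _   = sumPrimeDivUpTo-mono m⇒n k
... | no  _   | no  _  | no  _   = sumPrimeDivUpTo-mono m⇒n k

sumPrimeDivUpTo-beyond : ∀ n .{{_ : NonZero n}} {k} → n ℕ.≤ k → sumPrimeDivUpTo n k ≡ Π n
sumPrimeDivUpTo-beyond (suc _) {zero} ()
sumPrimeDivUpTo-beyond n {suc k} n≤1+k with m≤n⇒m<n∨m≡n n≤1+k
... | inj₂ refl      = refl
... | inj₁ (s≤s n≤k) with suc k ∣? n | prime? (suc k)
...   | yes k∣n | _ = contradiction (∣⇒≤ k∣n) (<⇒≱ (s≤s n≤k))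
...   | no  _   | yes _ = sumPrimeDivUpTo-beyond n n≤k
...   | no  _   | no  _ = sumPrimeDivUpTo-beyond n n≤k

Π[p*n]≤Π[n] : ∀ {p} n .{{_ : NonZero n}} → Prime p → p ∣ n → Π (p * n) ℕ.≤ Π n
Π[p*n]≤Π[n] {p} n pp p∣n = begin
  Π (p * n)                     ≤⟨ sumPrimeDivUpTo-mono primeFactor⇒∣n (p * n) ⟩
  sumPrimeDivUpTo n (p * n)     ≡⟨ sumPrimeDivUpTo-beyond n (m≤n*m n p) ⟩
  Π n                           ∎
  where
  open ≤-Reasoning
  instance _ = prime⇒nonZero pp
  primeFactor⇒∣n : ∀ {r} → Prime r → r ∣ p * n → r ∣ n
  primeFactor⇒∣n pr r∣pn with euclidsLemma p n pr r∣pn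
  ... | inj₂ r∣n = r∣n
  ... | inj₁ r∣p with prime⇒irreducible pp r∣p
  ...   | inj₁ refl = contradiction pr ¬prime[1]
  ...   | inj₂ refl = p∣n

+a-+b++c≡a+c⊖b : ∀ a b c → + a ℤ.- + b ℤ.+ + c ≡ (a + c) ⊖ b
+a-+b++c≡a+c⊖b a b c = begin
  + a ℤ.- + b ℤ.+ + c         ≡⟨ ℤ.+-assoc (+ a) (ℤ.- + b) (+ c) ⟩
  + a ℤ.+ (ℤ.- + b ℤ.+ + c)   ≡⟨ cong (ℤ._+_ (+ a)) (ℤ.+-comm (ℤ.- + b) (+ c)) ⟩
  + a ℤ.+ (+ c ℤ.- + b)       ≡⟨ sym (ℤ.+-assoc (+ a) (+ c) (ℤ.- + b)) ⟩
  + a ℤ.+ + c ℤ.- + b         ≡⟨ cong (ℤ._- + b) (sym (ℤ.pos-+ a c)) ⟩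
  + (a + c) ℤ.- + b           ≡⟨ ℤ.m-n≡m⊖n (a + c) b ⟩
  (a + c) ⊖ b                 ∎
  where open ≡-Reasoning

X≡⊖ : ∀ n → X n ≡ (Π n + n) ⊖ 𝒞 n
X≡⊖ n = +a-+b++c≡a+c⊖b (Π n) (𝒞 n) n

X≤0⇒Π+n≤𝒞 : ∀ n → X n ≤ + 0 → Π n + n ℕ.≤ 𝒞 n
X≤0⇒Π+n≤𝒞 n X≤0 = ℤ.drop‿+≤+ (ℤ.i-j≤0⇒i≤j (subst (_≤ + 0) X≡+[Π+n]-+𝒞 X≤0))
  where
  X≡+[Π+n]-+𝒞 : X n ≡ + (Π n + n) ℤ.- + 𝒞 n
  X≡+[Π+n]-+𝒞 = trans (X≡⊖ n) (sym (ℤ.m-n≡m⊖n (Π n + n) (𝒞 n)))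

Π+n<𝒞⇒X<0 : ∀ n → Π n + n ℕ.< 𝒞 n → X n < + 0
Π+n<𝒞⇒X<0 n Π+n<𝒞 = subst₂ _<_ (sym (X≡⊖ n)) (ℤ.n⊖n≡0 (Π n + n)) (ℤ.⊖-monoʳ->-< (Π n + n) Π+n<𝒞)

lemma3 : (n p : ℕ) → 1 Data.Nat.≤ n → X n ≤ + 0 → Prime p → p ∣ n → X (p * n) < + 0
lemma3 zero     p ()
lemma3 n@(suc _) p _ X≤0 pp p∣n = Π+n<𝒞⇒X<0 (p * n) (+-cancelˡ-< B (B + p * n) E B+[B+pn]<B+E)
  where
  instance
    _ = prime⇒nonTrivial pp
    _ = prime⇒nonZero pp
  A = Π n
  C = 𝒞 n
  B = Π (p * n)
  E = 𝒞 (p * n)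
  B≤A = Π[p*n]≤Π[n] n pp p∣n
  open ≤-Reasoning
  B+[B+pn]<B+E : B + (B + p * n) ℕ.< B + E
  B+[B+pn]<B+E = begin-strict
    B + (B + p * n)         ≤⟨ +-mono-≤ B≤A (+-monoˡ-≤ (p * n) B≤A) ⟩
    A + (A + p * n)         ≤⟨ +-mono-≤ (m≤n*m A p) (+-monoˡ-≤ (p * n) (m≤n*m A p)) ⟩
    p * A + (p * A + p * n) ≡⟨ cong (_+_ (p * A)) (sym (*-distribˡ-+ p A n)) ⟩
    p * A + p * (A + n)     ≤⟨ +-monoʳ-≤ (p * A) (*-monoʳ-≤ p (X≤0⇒Π+n≤𝒞 n X≤0)) ⟩
    p * A + p * C           ≡⟨ sym (*-distribˡ-+ p A C) ⟩
    p * (A + C)             ≡⟨ cong (p *_) (Π+𝒞≡σ n) ⟩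
    p * σ n                 <⟨ p*σ[n]<σ[p*n] p n ⟩
    σ (p * n)               ≡⟨ sym (Π+𝒞≡σ (p * n)) ⟩
    B + E                   ∎
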